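{- Let $M$ be a rank $3$ matroid on $[n]$ with no circuits of size $3$. Let $P_1,\dots,P_k$ be the distinct parallel classes of $M$ having more than one element, and let $N$ be the set of non-loop elements that are not parallel to any other element. Then $M$ is DJS if and only if $$\Big\lfloor\frac{|P_1|}{2}\Big\rfloor+\cdots+\Big\lfloor\frac{|P_k|}{2}\Big\rfloor-k<|N|-2.$$
   Context: A rank $3$ matroid $M$ on $[n]$ with set of bases $\mathcal{B}(M)$ is called DJS if, letting $E'$ be the set of non-loop elements of $M$, every ordering $w_1w_2\cdots w_m$ of $E'$ has some $j$ with $\{w_j,w_{j+1},w_{j+2}\}\in\mathcal{B}(M)$. -}

module Defs where

open import Data.Nat using (ℕ; _/_)
open import Data.Bool using (Bool; true; false)
open import Data.Fin using (Fin)
open import Data.Fin.Subset using (Subset; _∈_; _∉_; _⊆_; _∪_; _-_; ⁅_⁆; ∣_∣)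
open import Data.Product using (Σ; ∃; _×_; _,_)
open import Data.List using (List; []; _∷_; map; length)
open import Data.Nat.ListAction using (sum)
open import Data.Sum using (_⊎_)
open import Data.List.Relation.Unary.Any using (Any)
open import Data.List.Relation.Unary.Unique.Propositional using (Unique)
import Data.List.Membership.Propositional as L
open import Data.Integer using (ℤ; +_; _<_) renaming (_-_ to _-ℤ_)
open import Relation.Binary.PropositionalEquality using (_≡_; _≢_)
open import Relation.Nullary using (¬_)
open import Function.Bundles using (_⇔_)

-- A matroid on the ground set [n] = Fin n, given by its (finite, hence
-- decidable) family of bases, satisfying the basis axioms.
record Matroid (n : ℕ) : Set where
  field
    isBasis  : Subset n → Bool
    nonempty : ∃ λ B → isBasis B ≡ true
    exchange : ∀ B₁ B₂ → isBasis B₁ ≡ true → isBasis B₂ ≡ true →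
               ∀ x → x ∈ B₁ → x ∉ B₂ →
               ∃ λ y → y ∈ B₂ × y ∉ B₁ × isBasis ((B₁ - x) ∪ ⁅ y ⁆) ≡ true

module _ {n : ℕ} (M : Matroid n) where
  open Matroid M

  Basis : Subset n → Set
  Basis B = isBasis B ≡ true

  HasRank3 : Set
  HasRank3 = ∀ B → Basis B → ∣ B ∣ ≡ 3

  Independent : Subset n → Set
  Independent S = ∃ λ B → Basis B × S ⊆ B

  IsCircuit : Subset n → Set
  IsCircuit C = ¬ Independent C × (∀ x → x ∈ C → Independent (C - x))

  NoCircuitOfSize3 : Set
  NoCircuitOfSize3 = ∀ C → IsCircuit C → ∣ C ∣ ≢ 3

  IsLoop : Fin n → Set
  IsLoop x = ∀ B → Basis B → x ∉ B

  NonLoop : Fin n → Set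
  NonLoop x = ¬ IsLoop x

  Parallel : Fin n → Fin n → Set
  Parallel x y = NonLoop x × NonLoop y × x ≢ y × ¬ Independent (⁅ x ⁆ ∪ ⁅ y ⁆)

  IsParallelClass : Subset n → Set
  IsParallelClass P = ∃ λ x → NonLoop x ×
    (∀ y → (y ∈ P) ⇔ (y ≡ x ⊎ Parallel x y))

  IsOrderingOfNonLoops : List (Fin n) → Set
  IsOrderingOfNonLoops w = Unique w × (∀ x → (x L.∈ w) ⇔ NonLoop x)

  triples : List (Fin n) → List (Fin n × Fin n × Fin n)
  triples (a ∷ b ∷ c ∷ rest) = (a , b , c) ∷ triples (b ∷ c ∷ rest)
  triples _ = []

  IsDJS : Set
  IsDJS = ∀ w → IsOrderingOfNonLoops w →
    Any (λ { (a , b , c) → Basis (⁅ a ⁆ ∪ ⁅ b ⁆ ∪ ⁅ c ⁆) }) (triples w)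

halfSum : ∀ {n} → List (Subset n) → ℕ
halfSum Ps = sum (map (λ P → ∣ P ∣ / 2) Ps)

DJSInequality : ∀ {n} → List (Subset n) → Subset n → Set
DJSInequality Ps N = (+ halfSum Ps) -ℤ (+ length Ps) < (+ ∣ N ∣) -ℤ (+ 2)

module Submission where

-- In a rank-3 matroid without circuits of size 3, parallelism is an equivalence relation on the
-- non-loops, and three distinct non-loops form a basis exactly when no two of them are parallel.
-- Colour each non-loop by its parallel class and leave the elements of N blank: an ordering of E′
-- violates the DJS property exactly when every three consecutive letters contain two letters of
-- the same colour. Such a word exists iff |N| + k ≤ Σ ⌊|Pᵢ|/2⌋ + 2. If so, cut each class into
-- ⌊|Pᵢ|/2⌋ blocks of two or three elements and put one element of N into each gap between two
-- blocks of the same class and one at either end. Conversely, reading such a word from the right,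
-- Σᵢ weight (number of letters of colour Pᵢ read) + 2 − (number of blanks read) − k never becomes
-- negative, where weight 0 = 1 and weight m = ⌊m/2⌋ otherwise; for the whole word it is
-- Σ ⌊|Pᵢ|/2⌋ + 2 − |N| − k.

open import Defs

import Data.Bool as Bool
open import Data.Empty using (⊥)
open import Data.Fin as Fin using (Fin)
open import Data.Fin.Properties using (any?)
open import Data.Fin.Subset hiding (⊤; ⊥)
open import Data.Fin.Subset.Properties
import Data.Integer as ℤ
import Data.Integer.Properties as ℤ
import Data.Integer.Tactic.RingSolver as ℤ-Solver
open import Data.List using (List; []; _∷_; _++_; concat; length; map; filter; find; allFin)
open import Data.List.Properties using (map-cong-local; filter-accept; filter-reject; filter-some; ++-identityʳ)
open import Data.List.Membership.Propositional using () renaming (_∈_ to _∈L_)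
open import Data.List.Membership.Propositional.Properties
  using (∈-filter⁺; ∈-filter⁻; ∈-allFin; ∈-map⁺; ∈-map⁻; ∈-++⁺ˡ; ∈-++⁺ʳ; ∈-++⁻; ∈-concat⁺′; ∈-concat⁻′)
open import Data.List.Relation.Binary.Disjoint.Propositional using (Disjoint)
open import Data.List.Relation.Binary.Permutation.Propositional
  using (_↭_; prep; ↭-reflexive; ↭-sym; ↭-trans; ↭⇒↭ₛ)
open import Data.List.Relation.Binary.Permutation.Propositional.Properties using (∈-resp-↭; shifts)
open import Data.List.Relation.Unary.All as All using (All; []; _∷_)
import Data.List.Relation.Unary.All.Properties as All
open import Data.List.Relation.Unary.AllPairs using (AllPairs; []; _∷_)
open import Data.List.Relation.Unary.Any as Any using (Any; here; there)
open import Data.List.Relation.Unary.Linked using (Linked; []; [-]; _∷_)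
open import Data.List.Relation.Unary.Unique.Propositional using (Unique)
import Data.List.Relation.Unary.Unique.Propositional.Properties as Unique
open import Data.Maybe using (Maybe; just; nothing)
open import Data.Maybe.Properties using (just-injective) renaming (≡-dec to ≡-decₘ)
open import Data.Nat using (ℕ; zero; suc; _≤_; _<_; _+_; _∸_; z≤n; s≤s; _/_; ⌊_/2⌋)
open import Data.Nat.DivMod using (m/n≡1+[m∸n]/n)
open import Data.Nat.ListAction using (sum)
open import Data.Nat.Properties
  using ( ≤-refl; ≤-reflexive; ≤-trans; ≤-antisym; ≤-pred; <⇒≤; <⇒≱; ≤⇒≯; ≮⇒≥; _<?_; <-≤-trans; ≤-<-trans
        ; m<1+n⇒m≤n; n≤1+n; m≤m+n; m≤n+m; +-comm; +-assoc; +-suc; m∸n+n≡m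
        ; +-monoˡ-≤; +-monoʳ-≤; +-monoˡ-<; +-cancelʳ-≡; +-cancelʳ-≤; +-cancelʳ-<; ⌊n/2⌋-mono
        ; module ≤-Reasoning )
open import Data.Nat.Tactic.RingSolver using (solve-∀)
open import Data.Product as Product using (∃; _×_; _,_; proj₁; proj₂)
open import Data.Sum as Sum using (_⊎_; inj₁; inj₂)
open import Data.Unit using (⊤; tt)
open import Data.Vec using ([]; _∷_; here; there; tabulate)
open import Data.Vec.Properties as Vec using (lookup∘tabulate; []=⇒lookup; lookup⇒[]=)
open import Function.Base using (id; _∘_; case_of_)
open import Function.Bundles using (_⇔_; mk⇔; Equivalence)
open import Relation.Binary.Definitions using (DecidableEquality)
open import Relation.Binary.PropositionalEquality
open import Relation.Nullary using (¬_; Dec; yes; no; does; contradiction; ¬?)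
open import Relation.Nullary.Decidable as Dec using (_×-dec_; _⊎-dec_; decidable-stable; dec-true)

private variable
  n : ℕ
  p q : Subset n
  x y a b c : Fin n

module _ {A : Set} {P : A → Set} (P? : ∀ a → Dec (P a)) where

  find-just⁻ : ∀ {a} xs → find P? xs ≡ just a → a ∈L xs × P a
  find-just⁻ (x ∷ xs) found with P? x
  find-just⁻ (x ∷ xs) refl | yes Px = here refl , Px
  ... | no _ = Product.map₁ there (find-just⁻ xs found)

  find-nothing : ∀ xs → All (¬_ ∘ P) xs → find P? xs ≡ nothing
  find-nothing [] [] = refl
  find-nothing (x ∷ xs) (¬Px ∷ none) with P? x
  ... | yes Px = contradiction Px ¬Px
  ... | no _ = find-nothing xs none

  find-just : ∀ {a} xs → a ∈L xs → P a → All (λ b → P b → b ≡ a) xs → find P? xs ≡ just a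
  find-just (x ∷ xs) a∈ Pa (only ∷ onlys) with P? x
  ... | yes Px = cong just (only Px)
  ... | no ¬Px with a∈
  ...   | here refl = contradiction Pa ¬Px
  ...   | there a∈xs = find-just xs a∈xs Pa onlys

length-filter-map : ∀ {A B : Set} {P : B → Set} (P? : ∀ b → Dec (P b)) (f : A → B) xs →
  length (filter P? (map f xs)) ≡ length (filter (P? ∘ f) xs)
length-filter-map P? f [] = refl
length-filter-map P? f (x ∷ xs) with does (P? (f x))
... | Bool.true = cong suc (length-filter-map P? f xs)
... | Bool.false = length-filter-map P? f xs

AllPairs-map-local : ∀ {A B : Set} {R : A → A → Set} {S : B → B → Set} {f : A → B} {xs : List A} →
  (∀ {x y} → x ∈L xs → y ∈L xs → R x y → S (f x) (f y)) → AllPairs R xs → AllPairs S (map f xs)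
AllPairs-map-local f-resp [] = []
AllPairs-map-local f-resp (Rx ∷ Rxs) =
  All.map⁺ (All.tabulate λ y∈xs → f-resp (here refl) (there y∈xs) (All.lookup Rx y∈xs))
  ∷ AllPairs-map-local (λ x∈ y∈ → f-resp (there x∈) (there y∈)) Rxs

x∈p─q⇒x∉q : ∀ (p q : Subset n) → x ∈ p ─ q → x ∉ q
x∈p─q⇒x∉q (_ ∷ p) (outside ∷ q) here ()
x∈p─q⇒x∉q (_ ∷ p) (_ ∷ q) (there x∈p─q) (there x∈q) = x∈p─q⇒x∉q p q x∈p─q x∈q

x∈p-y⇒x≢y : x ∈ p - y → x ≢ y
x∈p-y⇒x≢y {p = p} {y = y} x∈p-y refl = x∈p─q⇒x∉q p ⁅ y ⁆ x∈p-y (x∈⁅x⁆ y)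

∣p∣≡1+∣p-x∣ : x ∈ p → ∣ p ∣ ≡ suc ∣ p - x ∣
∣p∣≡1+∣p-x∣ {p = inside ∷ p} here = cong suc (cong ∣_∣ (sym (p─⊥≡p p)))
∣p∣≡1+∣p-x∣ {p = inside ∷ p} (there x∈p) = cong suc (∣p∣≡1+∣p-x∣ x∈p)
∣p∣≡1+∣p-x∣ {p = outside ∷ p} (there x∈p) = ∣p∣≡1+∣p-x∣ x∈p

∣p∪q∣≤∣p∣+∣q∣ : ∀ (p q : Subset n) → ∣ p ∪ q ∣ ≤ ∣ p ∣ + ∣ q ∣
∣p∪q∣≤∣p∣+∣q∣ [] [] = z≤n
∣p∪q∣≤∣p∣+∣q∣ (inside ∷ p) (s ∷ q) =
  s≤s (≤-trans (∣p∪q∣≤∣p∣+∣q∣ p q) (+-monoʳ-≤ ∣ p ∣ (∣p∣≤∣x∷p∣ s q)))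
∣p∪q∣≤∣p∣+∣q∣ (outside ∷ p) (inside ∷ q) =
  ≤-trans (s≤s (∣p∪q∣≤∣p∣+∣q∣ p q)) (≤-reflexive (sym (+-suc ∣ p ∣ ∣ q ∣)))
∣p∪q∣≤∣p∣+∣q∣ (outside ∷ p) (outside ∷ q) = ∣p∪q∣≤∣p∣+∣q∣ p q

length≤∣p∣ : ∀ {xs : List (Fin n)} → Unique xs → All (_∈ p) xs → length xs ≤ ∣ p ∣
length≤∣p∣ [] [] = z≤n
length≤∣p∣ {p = p} {x ∷ xs} (x∉xs ∷ u) (x∈p ∷ xs⊆p) =
  ≤-trans (s≤s (length≤∣p∣ u xs⊆p-x)) (≤-reflexive (sym (∣p∣≡1+∣p-x∣ x∈p)))
  where
  xs⊆p-x : All (_∈ p - x) xs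
  xs⊆p-x = All.zipWith (λ (y∈p , x≢y) → x∈p∧x≢y⇒x∈p-y y∈p (≢-sym x≢y)) (xs⊆p , x∉xs)

length≡∣p∣ : ∀ {xs : List (Fin n)} → Unique xs → (∀ y → y ∈L xs ⇔ y ∈ p) → length xs ≡ ∣ p ∣
length≡∣p∣ {n} {p} {[]} [] xs⇔p =
  sym (trans (cong ∣_∣ (Empty-unique λ (y , y∈p) → case Equivalence.from (xs⇔p y) y∈p of λ ()))
             (∣⊥∣≡0 n))
length≡∣p∣ {p = p} {x ∷ xs} (x∉xs ∷ u) xs⇔p =
  trans (cong suc (length≡∣p∣ u xs⇔p-x)) (sym (∣p∣≡1+∣p-x∣ (Equivalence.to (xs⇔p x) (here refl))))
  where
  xs⇔p-x : ∀ y → y ∈L xs ⇔ y ∈ p - x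
  xs⇔p-x y = mk⇔
    (λ y∈xs → x∈p∧x≢y⇒x∈p-y (Equivalence.to (xs⇔p y) (there y∈xs))
                             (≢-sym (All.lookup x∉xs y∈xs)))
    (λ y∈p-x → drop-here (x∈p-y⇒x≢y y∈p-x) (Equivalence.from (xs⇔p y) (p─q⊆p p ⁅ x ⁆ y∈p-x)))
    where
    drop-here : y ≢ x → y ∈L x ∷ xs → y ∈L xs
    drop-here y≢x (here y≡x) = contradiction y≡x y≢x
    drop-here y≢x (there y∈xs) = y∈xs

p⊆q∧∣q∣≤∣p∣⇒p≡q : p ⊆ q → ∣ q ∣ ≤ ∣ p ∣ → p ≡ q
p⊆q∧∣q∣≤∣p∣⇒p≡q {p = p} {q} p⊆q ∣q∣≤∣p∣ = ⊆-antisym p⊆q q⊆p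
  where
  q⊆p : q ⊆ p
  q⊆p {x} x∈q with x ∈? p
  ... | yes x∈p = x∈p
  ... | no x∉p = contradiction (p⊂q⇒∣p∣<∣q∣ (p⊆q , x , x∈q , x∉p)) (≤⇒≯ ∣q∣≤∣p∣)

subset : ∀ {P : Fin n → Set} → (∀ x → Dec (P x)) → Subset n
subset P? = tabulate (does ∘ P?)

∈subset⇔ : ∀ {P : Fin n → Set} (P? : ∀ x → Dec (P x)) → x ∈ subset P? ⇔ P x
∈subset⇔ {x = x} P? = mk⇔
  (λ x∈ → does≡true⇒ (P? x) (trans (sym (lookup∘tabulate (does ∘ P?) x)) ([]=⇒lookup x∈)))
  (λ Px → lookup⇒[]= x _ (trans (lookup∘tabulate (does ∘ P?) x) (dec-true (P? x) Px)))
  where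
  does≡true⇒ : ∀ {A : Set} (a? : Dec A) → does a? ≡ Bool.true → A
  does≡true⇒ (yes a) _ = a

elements : Subset n → List (Fin n)
elements p = filter (_∈? p) (allFin _)

∈elements⇔ : x ∈L elements p ⇔ x ∈ p
∈elements⇔ {n} {x} {p} =
  mk⇔ (proj₂ ∘ ∈-filter⁻ (_∈? p) {xs = allFin n}) (∈-filter⁺ (_∈? p) (∈-allFin x))

elements-unique : ∀ (p : Subset n) → Unique (elements p)
elements-unique p = Unique.filter⁺ (_∈? p) (Unique.allFin⁺ _)

length-elements : ∀ (p : Subset n) → length (elements p) ≡ ∣ p ∣
length-elements p = length≡∣p∣ (elements-unique p) λ _ → ∈elements⇔

pair : Fin n → Fin n → Subset n
pair a b = ⁅ a ⁆ ∪ ⁅ b ⁆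

triple : Fin n → Fin n → Fin n → Subset n
triple a b c = ⁅ a ⁆ ∪ ⁅ b ⁆ ∪ ⁅ c ⁆

x∈pair⁻ : x ∈ pair a b → x ≡ a ⊎ x ≡ b
x∈pair⁻ {a = a} {b} x∈ab =
  Sum.map (x∈⁅y⁆⇒x≡y a) (x∈⁅y⁆⇒x≡y b) (x∈p∪q⁻ ⁅ a ⁆ ⁅ b ⁆ x∈ab)

x∈triple⁻ : x ∈ triple a b c → x ≡ a ⊎ x ≡ b ⊎ x ≡ c
x∈triple⁻ {a = a} {b} {c} x∈abc =
  Sum.map (x∈⁅y⁆⇒x≡y a) x∈pair⁻ (x∈p∪q⁻ ⁅ a ⁆ (pair b c) x∈abc)

a∈pair : ∀ (a b : Fin n) → a ∈ pair a b
a∈pair a b = x∈p∪q⁺ (inj₁ (x∈⁅x⁆ a))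

b∈pair : ∀ (a b : Fin n) → b ∈ pair a b
b∈pair a b = x∈p∪q⁺ (inj₂ (x∈⁅x⁆ b))

a∈triple : ∀ (a b c : Fin n) → a ∈ triple a b c
a∈triple a b c = x∈p∪q⁺ (inj₁ (x∈⁅x⁆ a))

b∈triple : ∀ (a b c : Fin n) → b ∈ triple a b c
b∈triple a b c = x∈p∪q⁺ (inj₂ (a∈pair b c))

c∈triple : ∀ (a b c : Fin n) → c ∈ triple a b c
c∈triple a b c = x∈p∪q⁺ (inj₂ (b∈pair b c))

pair⊆ : a ∈ p → b ∈ p → pair a b ⊆ p
pair⊆ a∈p b∈p x∈ab with x∈pair⁻ x∈ab
... | inj₁ refl = a∈p
... | inj₂ refl = b∈p

∣triple∣≤3 : ∀ (a b c : Fin n) → ∣ triple a b c ∣ ≤ 3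
∣triple∣≤3 a b c = begin
  ∣ ⁅ a ⁆ ∪ ⁅ b ⁆ ∪ ⁅ c ⁆ ∣
    ≤⟨ ∣p∪q∣≤∣p∣+∣q∣ ⁅ a ⁆ _ ⟩
  ∣ ⁅ a ⁆ ∣ + ∣ ⁅ b ⁆ ∪ ⁅ c ⁆ ∣
    ≤⟨ +-monoʳ-≤ ∣ ⁅ a ⁆ ∣ (∣p∪q∣≤∣p∣+∣q∣ ⁅ b ⁆ ⁅ c ⁆) ⟩
  ∣ ⁅ a ⁆ ∣ + (∣ ⁅ b ⁆ ∣ + ∣ ⁅ c ⁆ ∣)
    ≡⟨ cong₂ _+_ (∣⁅x⁆∣≡1 a) (cong₂ _+_ (∣⁅x⁆∣≡1 b) (∣⁅x⁆∣≡1 c)) ⟩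
  3 ∎
  where open ≤-Reasoning

triple-x⁻ : y ∈ triple a b c - x → y ≢ x × (y ≡ a ⊎ y ≡ b ⊎ y ≡ c)
triple-x⁻ y∈ = x∈p-y⇒x≢y y∈ , x∈triple⁻ (p─q⊆p _ _ y∈)

triple-a⊆pair : triple a b c - a ⊆ pair b c
triple-a⊆pair y∈ with triple-x⁻ y∈
... | y≢a , inj₁ y≡a        = contradiction y≡a y≢a
... | _   , inj₂ (inj₁ refl) = a∈pair _ _
... | _   , inj₂ (inj₂ refl) = b∈pair _ _

triple-b⊆pair : triple a b c - b ⊆ pair a c
triple-b⊆pair y∈ with triple-x⁻ y∈
... | _   , inj₁ refl        = a∈pair _ _
... | y≢b , inj₂ (inj₁ y≡b) = contradiction y≡b y≢b
... | _   , inj₂ (inj₂ refl) = b∈pair _ _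

triple-c⊆pair : triple a b c - c ⊆ pair a b
triple-c⊆pair y∈ with triple-x⁻ y∈
... | _   , inj₁ refl        = a∈pair _ _
... | _   , inj₂ (inj₁ refl) = b∈pair _ _
... | y≢c , inj₂ (inj₂ y≡c) = contradiction y≡c y≢c

⌊n/2⌋≡n/2 : ∀ m → ⌊ m /2⌋ ≡ m / 2
⌊n/2⌋≡n/2 zero = refl
⌊n/2⌋≡n/2 (suc zero) = refl
⌊n/2⌋≡n/2 (suc (suc m)) =
  trans (cong suc (⌊n/2⌋≡n/2 m)) (sym (m/n≡1+[m∸n]/n {suc (suc m)} {2} (s≤s (s≤s z≤n))))

m+o≤n+p∧n<o⇒m<p : ∀ {m n o p} → m + o ≤ n + p → n < o → m < p
m+o≤n+p∧n<o⇒m<p {m} {n} {o} {p} le n<o =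
  +-cancelʳ-< o m p (≤-<-trans le (subst (n + p <_) (+-comm o p) (+-monoˡ-< p n<o)))

+m-+n<+o-+p⇔m+p<o+n : ∀ m n o p → (ℤ.+ m ℤ.- ℤ.+ n ℤ.< ℤ.+ o ℤ.- ℤ.+ p) ⇔ (m + p < o + n)
+m-+n<+o-+p⇔m+p<o+n m n o p = mk⇔
  (λ lt → ℤ.drop‿+<+ (subst₂ ℤ._<_
    (trans (add₁ (ℤ.+ m) (ℤ.+ n) (ℤ.+ p)) (sym (ℤ.pos-+ m p)))
    (trans (add₂ (ℤ.+ o) (ℤ.+ n) (ℤ.+ p)) (sym (ℤ.pos-+ o n)))
    (ℤ.+-monoˡ-< (ℤ.+ n ℤ.+ ℤ.+ p) lt)))
  (λ lt → subst₂ ℤ._<_ (sub₁ (ℤ.+ m) (ℤ.+ n) (ℤ.+ p)) (sub₂ (ℤ.+ o) (ℤ.+ n) (ℤ.+ p))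
    (ℤ.+-monoˡ-< (ℤ.- ℤ.+ n ℤ.- ℤ.+ p) (subst₂ ℤ._<_ (ℤ.pos-+ m p) (ℤ.pos-+ o n) (ℤ.+<+ lt))))
  where
  add₁ : ∀ x y z → x ℤ.- y ℤ.+ (y ℤ.+ z) ≡ x ℤ.+ z
  add₁ = ℤ-Solver.solve-∀
  add₂ : ∀ x y z → x ℤ.- z ℤ.+ (y ℤ.+ z) ≡ x ℤ.+ y
  add₂ = ℤ-Solver.solve-∀
  sub₁ : ∀ x y z → x ℤ.+ z ℤ.+ (ℤ.- y ℤ.- z) ≡ x ℤ.- y
  sub₁ = ℤ-Solver.solve-∀
  sub₂ : ∀ x y z → x ℤ.+ y ℤ.+ (ℤ.- y ℤ.- z) ≡ x ℤ.- z
  sub₂ = ℤ-Solver.solve-∀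

module MatroidProperties {n : ℕ} (M : Matroid n) where
  open Matroid M

  private variable
    S T B B′ : Subset n

  independent? : ∀ S → Dec (Independent M S)
  independent? S = anySubset? λ B → (isBasis B Bool.≟ Bool.true) ×-dec (S ⊆? B)

  independent-⊆ : S ⊆ T → Independent M T → Independent M S
  independent-⊆ S⊆T (B , basis , T⊆B) = B , basis , λ x∈S → T⊆B (S⊆T x∈S)

  basis⇒independent : Basis M B → S ⊆ B → Independent M S
  basis⇒independent basis S⊆B = _ , basis , S⊆B

  nonLoop⇒independent : NonLoop M x → Independent M ⁅ x ⁆
  nonLoop⇒independent {x} nonLoop with independent? ⁅ x ⁆
  ... | yes ind = ind
  ... | no ¬ind = contradiction (λ B basis x∈B → ¬ind (B , basis , ⁅x⁆⊆ x∈B)) nonLoop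
    where
    ⁅x⁆⊆ : ∀ {B} → x ∈ B → ⁅ x ⁆ ⊆ B
    ⁅x⁆⊆ {B} x∈B y∈x = subst (_∈ B) (sym (x∈⁅y⁆⇒x≡y x y∈x)) x∈B

  independent⇒nonLoop : Independent M ⁅ x ⁆ → NonLoop M x
  independent⇒nonLoop {x} (B , basis , x⊆B) loop = loop B basis (x⊆B (x∈⁅x⁆ x))

  nonLoop? : ∀ x → Dec (NonLoop M x)
  nonLoop? x = Dec.map′ independent⇒nonLoop nonLoop⇒independent (independent? ⁅ x ⁆)

  parallel? : ∀ x y → Dec (Parallel M x y)
  parallel? x y = nonLoop? x ×-dec nonLoop? y ×-dec ¬? (x Fin.≟ y) ×-dec ¬? (independent? (pair x y))

  parallel-sym : Parallel M x y → Parallel M y x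
  parallel-sym {x} {y} (nx , ny , x≢y , dep) =
    ny , nx , ≢-sym x≢y , dep ∘ subst (Independent M) (∪-comm ⁅ y ⁆ ⁅ x ⁆)

  ¬parallel⇒independent : NonLoop M x → NonLoop M y → x ≢ y → ¬ Parallel M x y →
                           Independent M (pair x y)
  ¬parallel⇒independent {x} {y} nx ny x≢y ¬par with independent? (pair x y)
  ... | yes ind = ind
  ... | no dep = contradiction (nx , ny , x≢y , dep) ¬par

  x∈basis⇒basis∋x⊆B∪⁅x⁆ : Basis M B → Basis M B′ → x ∈ B′ →
                          ∃ λ B″ → Basis M B″ × x ∈ B″ × B″ ⊆ B ∪ ⁅ x ⁆
  x∈basis⇒basis∋x⊆B∪⁅x⁆ {B} {B′} {x} basis basis′ x∈B′ =
    go (suc ∣ B′ ─ B ∣) B′ ≤-refl basis′ x∈B′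
    where
    go : ∀ k B′ → ∣ B′ ─ B ∣ < k → Basis M B′ → x ∈ B′ →
         ∃ λ B″ → Basis M B″ × x ∈ B″ × B″ ⊆ B ∪ ⁅ x ⁆
    go (suc k) B′ <k basis′ x∈B′ with any? (λ z → z ∈? B′ ×-dec ¬? (z ∈? B ∪ ⁅ x ⁆))
    ... | no none =
      B′ , basis′ , x∈B′ , λ {z} z∈B′ → decidable-stable (z ∈? B ∪ ⁅ x ⁆) λ z∉ → none (z , z∈B′ , z∉)
    ... | yes (z , z∈B′ , z∉) with exchange B′ B basis′ basis z z∈B′ (z∉ ∘ x∈p∪q⁺ ∘ inj₁)
    ...   | e , e∈B , _ , basis₂ =
      go k ((B′ - z) ∪ ⁅ e ⁆) (<-≤-trans (p⊂q⇒∣p∣<∣q∣ shrinks) (≤-pred <k)) basis₂ x∈B₂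
      where
      z≢x : z ≢ x
      z≢x refl = z∉ (x∈p∪q⁺ (inj₂ (x∈⁅x⁆ x)))
      x∈B₂ : x ∈ (B′ - z) ∪ ⁅ e ⁆
      x∈B₂ = x∈p∪q⁺ (inj₁ (x∈p∧x≢y⇒x∈p-y x∈B′ (≢-sym z≢x)))
      B₂─B⊆B′-z : (B′ - z) ∪ ⁅ e ⁆ ─ B ⊆ B′ - z
      B₂─B⊆B′-z {w} w∈ with x∈p∪q⁻ (B′ - z) ⁅ e ⁆ (p─q⊆p _ B w∈)
      ... | inj₁ w∈B′-z = w∈B′-z
      ... | inj₂ w∈e =
        contradiction (subst (_∈ B) (sym (x∈⁅y⁆⇒x≡y e w∈e)) e∈B) (x∈p─q⇒x∉q _ B w∈)
      shrinks : (B′ - z) ∪ ⁅ e ⁆ ─ B ⊂ B′ ─ B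
      shrinks = (λ w∈ → x∈p∧x∉q⇒x∈p─q (p─q⊆p B′ ⁅ z ⁆ (B₂─B⊆B′-z w∈)) (x∈p─q⇒x∉q _ B w∈))
              , z , x∈p∧x∉q⇒x∈p─q z∈B′ (z∉ ∘ x∈p∪q⁺ ∘ inj₁)
              , λ z∈ → x∈p-y⇒x≢y (B₂─B⊆B′-z z∈) refl

  ∈basis⇒¬parallel : Basis M B → x ∈ B → y ∈ B → ¬ Parallel M x y
  ∈basis⇒¬parallel basis x∈B y∈B (_ , _ , _ , dep) = dep (basis⇒independent basis (pair⊆ x∈B y∈B))

  module WithEquicardinalBases
    (equicardinal : ∀ B B′ → Basis M B → Basis M B′ → ∣ B ∣ ≡ ∣ B′ ∣) where

    parallel-trans : Parallel M a b → Parallel M b c → a ≢ c → Parallel M a c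
    parallel-trans {a} {b} {c} (na , nb , _ , a∦b) (_ , nc , _ , b∦c) a≢c = na , nc , a≢c , a∦c
      where
      a∦c : ¬ Independent M (pair a c)
      a∦c (B , basis , ac⊆B) with nonLoop⇒independent nb
      ... | B′ , basis′ , b⊆B′ with x∈basis⇒basis∋x⊆B∪⁅x⁆ basis basis′ (b⊆B′ (x∈⁅x⁆ b))
      ... | B″ , basis″ , b∈B″ , B″⊆B∪b with a ∈? B″ | c ∈? B″
      ... | yes a∈B″ | _ = a∦b (basis⇒independent basis″ (pair⊆ a∈B″ b∈B″))
      ... | no _ | yes c∈B″ = b∦c (basis⇒independent basis″ (pair⊆ b∈B″ c∈B″))
      ... | no a∉B″ | no c∉B″ = ≤⇒≯ ∣B″∣≤ (≤-reflexive (sym ∣B∣≡))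
        where
        a∈B : a ∈ B
        a∈B = ac⊆B (a∈pair a c)
        c∈B-a : c ∈ B - a
        c∈B-a = x∈p∧x≢y⇒x∈p-y (ac⊆B (b∈pair a c)) (≢-sym a≢c)
        ∣B∣≡ : ∣ B ∣ ≡ 2 + ∣ B - a - c ∣
        ∣B∣≡ = trans (∣p∣≡1+∣p-x∣ a∈B) (cong suc (∣p∣≡1+∣p-x∣ c∈B-a))
        B″⊆ : B″ ⊆ (B - a - c) ∪ ⁅ b ⁆
        B″⊆ {w} w∈B″ with x∈p∪q⁻ B ⁅ b ⁆ (B″⊆B∪b w∈B″)
        ... | inj₂ w∈b = x∈p∪q⁺ (inj₂ w∈b)
        ... | inj₁ w∈B = x∈p∪q⁺ (inj₁ (x∈p∧x≢y⇒x∈p-y (x∈p∧x≢y⇒x∈p-y w∈B λ { refl → a∉B″ w∈B″ })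
                                                     λ { refl → c∉B″ w∈B″ }))
        ∣B″∣≤ : ∣ B ∣ ≤ 1 + ∣ B - a - c ∣
        ∣B″∣≤ = begin
          ∣ B ∣                           ≡⟨ equicardinal B B″ basis basis″ ⟩
          ∣ B″ ∣                          ≤⟨ p⊆q⇒∣p∣≤∣q∣ B″⊆ ⟩
          ∣ (B - a - c) ∪ ⁅ b ⁆ ∣           ≤⟨ ∣p∪q∣≤∣p∣+∣q∣ (B - a - c) ⁅ b ⁆ ⟩
          ∣ B - a - c ∣ + ∣ ⁅ b ⁆ ∣       ≡⟨ cong (∣ B - a - c ∣ +_) (∣⁅x⁆∣≡1 b) ⟩
          ∣ B - a - c ∣ + 1               ≡⟨ +-comm ∣ B - a - c ∣ 1 ⟩
          1 + ∣ B - a - c ∣               ∎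
          where open ≤-Reasoning

    private variable
      P Q : Subset n

    class-∈⇒parallel : IsParallelClass M P → x ∈ P → y ∈ P → x ≡ y ⊎ Parallel M x y
    class-∈⇒parallel {P} {x} {y} (z , _ , P⇔) x∈P y∈P
      with Equivalence.to (P⇔ x) x∈P | Equivalence.to (P⇔ y) y∈P | x Fin.≟ y
    ... | _              | _              | yes x≡y = inj₁ x≡y
    ... | inj₁ refl      | inj₁ refl      | no x≢y  = contradiction refl x≢y
    ... | inj₁ refl      | inj₂ x∥y       | no _    = inj₂ x∥y
    ... | inj₂ z∥x       | inj₁ refl      | no _    = inj₂ (parallel-sym z∥x)
    ... | inj₂ z∥x       | inj₂ z∥y       | no x≢y  = inj₂ (parallel-trans (parallel-sym z∥x) z∥y x≢y)

    class-∈⇒nonLoop : IsParallelClass M P → x ∈ P → NonLoop M x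
    class-∈⇒nonLoop {P} {x} (z , nz , P⇔) x∈P with Equivalence.to (P⇔ x) x∈P
    ... | inj₁ refl = nz
    ... | inj₂ (_ , nx , _) = nx

    class-closed : IsParallelClass M P → x ∈ P → Parallel M x y → y ∈ P
    class-closed {P} {x} {y} (z , _ , P⇔) x∈P x∥y with Equivalence.to (P⇔ x) x∈P | y Fin.≟ z
    ... | _         | yes y≡z = Equivalence.from (P⇔ y) (inj₁ y≡z)
    ... | inj₁ refl | no _    = Equivalence.from (P⇔ y) (inj₂ x∥y)
    ... | inj₂ z∥x  | no y≢z  = Equivalence.from (P⇔ y) (inj₂ (parallel-trans z∥x x∥y (≢-sym y≢z)))

    class-unique : IsParallelClass M P → IsParallelClass M Q → x ∈ P → x ∈ Q → P ≡ Q
    class-unique {P} {Q} {x} P-class Q-class x∈P x∈Q =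
      ⊆-antisym (⊆-other P-class Q-class x∈P x∈Q) (⊆-other Q-class P-class x∈Q x∈P)
      where
      ⊆-other : ∀ {P Q} → IsParallelClass M P → IsParallelClass M Q → x ∈ P → x ∈ Q → P ⊆ Q
      ⊆-other P-class Q-class x∈P x∈Q y∈P with class-∈⇒parallel P-class x∈P y∈P
      ... | inj₁ refl = x∈Q
      ... | inj₂ x∥y = class-closed Q-class x∈Q x∥y

    class-of : Parallel M x y → ∃ λ P → IsParallelClass M P × x ∈ P × y ∈ P
    class-of {x} {y} x∥y@(nx , _) =
      subset x≡∨∥? , (x , nx , λ z → ∈subset⇔ x≡∨∥?) , from⇔ (inj₁ refl) , from⇔ (inj₂ x∥y)
      where
      x≡∨∥? : ∀ z → Dec (z ≡ x ⊎ Parallel M x z)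
      x≡∨∥? z = (z Fin.≟ x) ⊎-dec parallel? x z
      from⇔ : ∀ {z} → z ≡ x ⊎ Parallel M x z → z ∈ subset x≡∨∥?
      from⇔ = Equivalence.from (∈subset⇔ x≡∨∥?)

  module _ (rank3 : HasRank3 M) (noCircuit3 : NoCircuitOfSize3 M) where

    pairwise-independent⇒basis : a ≢ b → a ≢ c → b ≢ c →
      Independent M (pair a b) → Independent M (pair a c) → Independent M (pair b c) →
      Basis M (triple a b c)
    pairwise-independent⇒basis {a} {b} {c} a≢b a≢c b≢c ab ac bc = decide (independent? abc)
      where
      abc : Subset n
      abc = triple a b c
      3≤∣abc∣ : 3 ≤ ∣ abc ∣
      3≤∣abc∣ = length≤∣p∣ ((a≢b ∷ a≢c ∷ []) ∷ (b≢c ∷ []) ∷ [] ∷ [])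
                        (a∈triple a b c ∷ b∈triple a b c ∷ c∈triple a b c ∷ [])
      abc-x-independent : ∀ x → x ∈ abc → Independent M (abc - x)
      abc-x-independent x x∈abc = case x∈triple⁻ x∈abc of λ where
        (inj₁ refl)        → independent-⊆ triple-a⊆pair bc
        (inj₂ (inj₁ refl)) → independent-⊆ triple-b⊆pair ac
        (inj₂ (inj₂ refl)) → independent-⊆ triple-c⊆pair ab
      decide : Dec (Independent M abc) → Basis M abc
      decide (yes (B , basis , abc⊆B)) =
        subst (Basis M) (sym (p⊆q∧∣q∣≤∣p∣⇒p≡q abc⊆B (≤-trans (≤-reflexive (rank3 B basis)) 3≤∣abc∣)))
              basis
      decide (no dep) =
        contradiction (≤-antisym (∣triple∣≤3 a b c) 3≤∣abc∣) (noCircuit3 abc (dep , abc-x-independent))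

oddness : ℕ → ℕ
oddness zero = 0
oddness (suc zero) = 1
oddness (suc (suc m)) = oddness m

oddness≤1 : ∀ m → oddness m ≤ 1
oddness≤1 zero = z≤n
oddness≤1 (suc zero) = ≤-refl
oddness≤1 (suc (suc m)) = oddness≤1 m

oddness+oddness-suc≡1 : ∀ m → oddness m + oddness (suc m) ≡ 1
oddness+oddness-suc≡1 zero = refl
oddness+oddness-suc≡1 (suc zero) = refl
oddness+oddness-suc≡1 (suc (suc m)) = oddness+oddness-suc≡1 m

⌊1+m/2⌋+oddness[1+m]≡1+⌊m/2⌋ : ∀ m → ⌊ suc m /2⌋ + oddness (suc m) ≡ suc ⌊ m /2⌋
⌊1+m/2⌋+oddness[1+m]≡1+⌊m/2⌋ zero = refl
⌊1+m/2⌋+oddness[1+m]≡1+⌊m/2⌋ (suc zero) = refl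
⌊1+m/2⌋+oddness[1+m]≡1+⌊m/2⌋ (suc (suc m)) = cong suc (⌊1+m/2⌋+oddness[1+m]≡1+⌊m/2⌋ m)

weight : ℕ → ℕ
weight zero = 1
weight (suc m) = ⌊ suc m /2⌋

weight-suc : ∀ m → 1 ≤ m → weight (suc m) ≡ weight m + oddness m
weight-suc (suc m) _ = sym (⌊1+m/2⌋+oddness[1+m]≡1+⌊m/2⌋ m)

weight≤weight-suc+oddness : ∀ m → weight m ≤ weight (suc m) + oddness (suc m)
weight≤weight-suc+oddness zero = ≤-refl
weight≤weight-suc+oddness (suc m) = ≤-trans (⌊n/2⌋-mono (n≤1+n (suc m))) (m≤m+n _ _)

weight≡/2 : ∀ {m} → 1 ≤ m → weight m ≡ m / 2
weight≡/2 {suc m} _ = ⌊n/2⌋≡n/2 (suc m)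

module _ {A : Set} (R : A → A → Set) where

  Paired : A → A → A → Set
  Paired a b c = R a b ⊎ R b c ⊎ R a c

  WindowsPaired : List A → Set
  WindowsPaired (a ∷ b ∷ c ∷ w) = Paired a b c × WindowsPaired (b ∷ c ∷ w)
  WindowsPaired _ = ⊤

WindowsPaired-map : ∀ {A B : Set} {R : B → B → Set} (f : A → B) w →
  WindowsPaired (λ x y → R (f x) (f y)) w → WindowsPaired R (map f w)
WindowsPaired-map f (a ∷ b ∷ c ∷ w) (abc , paired) = abc , WindowsPaired-map f (b ∷ c ∷ w) paired
WindowsPaired-map f [] _ = tt
WindowsPaired-map f (_ ∷ []) _ = tt
WindowsPaired-map f (_ ∷ _ ∷ []) _ = tt

module Colours {C : Set} (_≟_ : DecidableEquality C) where

  private variable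
    P Q : C
    u : List (Maybe C)

  Same : Maybe C → Maybe C → Set
  Same (just P) (just Q) = P ≡ Q
  Same _ _ = ⊥

  same? : ∀ x y → Dec (Same x y)
  same? (just P) (just Q) = P ≟ Q
  same? (just _) nothing = no λ ()
  same? nothing _ = no λ ()

  same-sym : ∀ x y → Same x y → Same y x
  same-sym (just P) (just Q) = sym

  count : C → List (Maybe C) → ℕ
  count P u = length (filter (≡-decₘ _≟_ (just P)) u)

  blanks : List (Maybe C) → ℕ
  blanks u = length (filter (≡-decₘ _≟_ nothing) u)

  count-here : ∀ u → count P (just P ∷ u) ≡ suc (count P u)
  count-here {P} u = cong length (filter-accept (≡-decₘ _≟_ (just P)) {xs = u} refl)

  count-there : ∀ u → P ≢ Q → count Q (just P ∷ u) ≡ count Q u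
  count-there {P} {Q} u P≢Q =
    cong length (filter-reject (≡-decₘ _≟_ (just Q)) {xs = u} λ Q≡P → P≢Q (sym (just-injective Q≡P)))

  count-blank : ∀ u → count Q (nothing ∷ u) ≡ count Q u
  count-blank {Q} u = cong length (filter-reject (≡-decₘ _≟_ (just Q)) {x = nothing} {xs = u} λ ())

  blanks-blank : ∀ u → blanks (nothing ∷ u) ≡ suc (blanks u)
  blanks-blank u = cong length (filter-accept (≡-decₘ _≟_ nothing) {xs = u} refl)

  blanks-just : ∀ u → blanks (just P ∷ u) ≡ blanks u
  blanks-just {P} u = cong length (filter-reject (≡-decₘ _≟_ nothing) {x = just P} {xs = u} λ ())

  Weight : List C → List (Maybe C) → ℕ
  Weight Ds u = sum (map (λ P → weight (count P u)) Ds)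

  Weight-[] : ∀ Ds → Weight Ds [] ≡ length Ds
  Weight-[] [] = refl
  Weight-[] (_ ∷ Ds) = cong suc (Weight-[] Ds)

  Weight-blank : ∀ Ds u → Weight Ds (nothing ∷ u) ≡ Weight Ds u
  Weight-blank [] u = refl
  Weight-blank (Q ∷ Ds) u = cong₂ _+_ (cong weight (count-blank u)) (Weight-blank Ds u)

  Weight-absent : ∀ Ds u → All (P ≢_) Ds → Weight Ds (just P ∷ u) ≡ Weight Ds u
  Weight-absent [] u [] = refl
  Weight-absent (Q ∷ Ds) u (P≢Q ∷ P∉Ds) =
    cong₂ _+_ (cong weight (count-there u P≢Q)) (Weight-absent Ds u P∉Ds)

  Weight-just : ∀ Ds → Unique Ds → P ∈L Ds →
    Weight Ds (just P ∷ u) + weight (count P u) ≡ Weight Ds u + weight (suc (count P u))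
  Weight-just {P} {u} (P ∷ Ds) (P∉Ds ∷ _) (here refl) = begin
    weight (count P (just P ∷ u)) + Weight Ds (just P ∷ u) + weight (count P u)
      ≡⟨ cong₂ (λ a b → weight a + b + weight (count P u)) (count-here u) (Weight-absent Ds u P∉Ds) ⟩
    weight (suc (count P u)) + Weight Ds u + weight (count P u)
      ≡⟨ swap-outer (weight (suc (count P u))) (Weight Ds u) (weight (count P u)) ⟩
    weight (count P u) + Weight Ds u + weight (suc (count P u)) ∎
    where
    open ≡-Reasoning
    swap-outer : ∀ a b c → a + b + c ≡ c + b + a
    swap-outer = solve-∀
  Weight-just {P} {u} (Q ∷ Ds) (Q∉Ds ∷ unique) (there P∈Ds) = begin
    weight (count Q (just P ∷ u)) + Weight Ds (just P ∷ u) + weight (count P u)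
      ≡⟨ cong (λ a → weight a + Weight Ds (just P ∷ u) + weight (count P u)) (count-there u P≢Q) ⟩
    weight (count Q u) + Weight Ds (just P ∷ u) + weight (count P u)
      ≡⟨ +-assoc (weight (count Q u)) _ _ ⟩
    weight (count Q u) + (Weight Ds (just P ∷ u) + weight (count P u))
      ≡⟨ cong (weight (count Q u) +_) (Weight-just Ds unique P∈Ds) ⟩
    weight (count Q u) + (Weight Ds u + weight (suc (count P u)))
      ≡⟨ +-assoc (weight (count Q u)) _ _ ⟨
    weight (count Q u) + Weight Ds u + weight (suc (count P u)) ∎
    where
    open ≡-Reasoning
    P≢Q : P ≢ Q
    P≢Q refl = All.lookup Q∉Ds P∈Ds refl

  Weight-repeat : ∀ Ds → Unique Ds → P ∈L Ds → 1 ≤ count P u →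
    Weight Ds (just P ∷ u) ≡ oddness (count P u) + Weight Ds u
  Weight-repeat {P} {u} Ds unique P∈Ds 1≤m = +-cancelʳ-≡ (weight m) _ _ (begin
    Weight Ds (just P ∷ u) + weight m      ≡⟨ Weight-just Ds unique P∈Ds ⟩
    Weight Ds u + weight (suc m)           ≡⟨ cong (Weight Ds u +_) (weight-suc m 1≤m) ⟩
    Weight Ds u + (weight m + oddness m)   ≡⟨ rearrange (Weight Ds u) (weight m) (oddness m) ⟩
    oddness m + Weight Ds u + weight m     ∎)
    where
    open ≡-Reasoning
    m : ℕ
    m = count P u
    rearrange : ∀ a b c → a + (b + c) ≡ c + a + b
    rearrange = solve-∀

  Weight≤oddness+Weight-just : ∀ Ds → Unique Ds → P ∈L Ds →
    Weight Ds u ≤ oddness (count P (just P ∷ u)) + Weight Ds (just P ∷ u)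
  Weight≤oddness+Weight-just {P} {u} Ds unique P∈Ds = +-cancelʳ-≤ (weight (suc m)) _ _ (begin
    Weight Ds u + weight (suc m)
      ≡⟨ Weight-just Ds unique P∈Ds ⟨
    W′ + weight m
      ≤⟨ +-monoʳ-≤ W′ (weight≤weight-suc+oddness m) ⟩
    W′ + (weight (suc m) + oddness (suc m))
      ≡⟨ rearrange W′ (weight (suc m)) (oddness (suc m)) ⟩
    oddness (suc m) + W′ + weight (suc m)
      ≡⟨ cong (λ k → oddness k + W′ + weight (suc m)) (count-here u) ⟨
    oddness (count P (just P ∷ u)) + W′ + weight (suc m) ∎)
    where
    open ≤-Reasoning
    m W′ : ℕ
    m = count P u
    W′ = Weight Ds (just P ∷ u)
    rearrange : ∀ a b c → a + (b + c) ≡ c + a + b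
    rearrange = solve-∀

  Listed : List C → Maybe C → Set
  Listed Cs nothing = ⊤
  Listed Cs (just P) = P ∈L Cs

  module Capacity (Cs : List C) (unique : Unique Cs) where

    demand : List (Maybe C) → ℕ
    demand u = blanks u + length Cs

    capacity : List (Maybe C) → ℕ
    capacity u = Weight Cs u + 2

    -- 1 unless the first letter of the word is coloured and, read from the right,
    -- completes a pair of its colour.
    pending : Maybe C → List (Maybe C) → ℕ
    pending nothing _ = 1
    pending (just P) u = oddness (count P u)

    pending≤1 : ∀ z u → pending z u ≤ 1
    pending≤1 nothing _ = ≤-refl
    pending≤1 (just P) u = oddness≤1 (count P u)

    capacity-[] : capacity [] ≡ 2 + demand []
    capacity-[] = trans (cong (_+ 2) (Weight-[] Cs)) (+-comm (length Cs) 2)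

    capacity-repeat : P ∈L Cs → 1 ≤ count P u → capacity (just P ∷ u) ≡ oddness (count P u) + capacity u
    capacity-repeat {P} {u} P∈Cs 1≤m =
      trans (cong (_+ 2) (Weight-repeat Cs unique P∈Cs 1≤m)) (+-assoc (oddness (count P u)) _ 2)

    prepend-cost : ∀ z u → Listed Cs z →
      demand (z ∷ u) + capacity u ≤ demand u + (pending z (z ∷ u) + capacity (z ∷ u))
    prepend-cost nothing u _ = ≤-reflexive (begin
      blanks (nothing ∷ u) + length Cs + (Weight Cs u + 2)
        ≡⟨ cong₂ (λ b W → b + length Cs + (W + 2)) (blanks-blank u) (sym (Weight-blank Cs u)) ⟩
      suc (blanks u) + length Cs + (Weight Cs (nothing ∷ u) + 2)
        ≡⟨ rearrange (blanks u) (length Cs) (Weight Cs (nothing ∷ u) + 2) ⟩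
      blanks u + length Cs + suc (Weight Cs (nothing ∷ u) + 2) ∎)
      where
      open ≡-Reasoning
      rearrange : ∀ b k c → suc b + k + c ≡ b + k + suc c
      rearrange = solve-∀
    prepend-cost (just P) u P∈Cs = +-monoʳ-≤ (demand u) (begin
      Weight Cs u + 2                           ≤⟨ +-monoˡ-≤ 2 (Weight≤oddness+Weight-just Cs unique P∈Cs) ⟩
      oddness m′ + Weight Cs (just P ∷ u) + 2   ≡⟨ +-assoc (oddness m′) _ 2 ⟩
      oddness m′ + (Weight Cs (just P ∷ u) + 2) ∎)
      where
      open ≤-Reasoning
      m′ : ℕ
      m′ = count P (just P ∷ u)

    Roomy : List (Maybe C) → Set
    Roomy u = demand u < capacity u

    RoomyIfPending : Maybe C → List (Maybe C) → Set
    RoomyIfPending z u = demand u < pending z u + capacity u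

    prepend-roomy : ∀ z u → Listed Cs z → Roomy u → RoomyIfPending z (z ∷ u)
    prepend-roomy z u z∈Cs = m+o≤n+p∧n<o⇒m<p (prepend-cost z u z∈Cs)

    single-roomy : ∀ y → Listed Cs y → Roomy (y ∷ [])
    single-roomy y y∈Cs = m+o≤n+p∧n<o⇒m<p (begin
      demand (y ∷ []) + capacity []
        ≤⟨ prepend-cost y [] y∈Cs ⟩
      demand [] + (pending y (y ∷ []) + capacity (y ∷ []))
        ≤⟨ +-monoʳ-≤ (demand []) (+-monoˡ-≤ (capacity (y ∷ [])) (pending≤1 y (y ∷ []))) ⟩
      demand [] + suc (capacity (y ∷ []))
        ≡⟨ +-suc (demand []) (capacity (y ∷ [])) ⟩
      suc (demand []) + capacity (y ∷ []) ∎)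
      (≤-reflexive (sym capacity-[]))
      where open ≤-Reasoning

    repeat-roomy : ∀ P u → P ∈L Cs → RoomyIfPending (just P) (just P ∷ u) →
                   Roomy (just P ∷ just P ∷ u)
    repeat-roomy P u P∈Cs room = begin-strict
      demand (just P ∷ just P ∷ u)
        ≡⟨ cong (_+ length Cs) (blanks-just {P} (just P ∷ u)) ⟩
      demand (just P ∷ u)
        <⟨ room ⟩
      oddness (count P (just P ∷ u)) + capacity (just P ∷ u)
        ≡⟨ capacity-repeat P∈Cs (filter-some (≡-decₘ _≟_ (just P)) (here refl)) ⟨
      capacity (just P ∷ just P ∷ u) ∎
      where open ≤-Reasoning

    occurring-roomy : ∀ P u → P ∈L Cs → 1 ≤ count P u → demand u < 1 + capacity u →
      RoomyIfPending (just P) (just P ∷ u)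
    occurring-roomy P u P∈Cs 1≤m room = begin-strict
      demand (just P ∷ u)
        ≡⟨ cong (_+ length Cs) (blanks-just {P} u) ⟩
      demand u
        <⟨ room ⟩
      1 + capacity u
        ≡⟨ cong (_+ capacity u) (oddness+oddness-suc≡1 m) ⟨
      oddness m + oddness (suc m) + capacity u
        ≡⟨ rearrange (oddness m) (oddness (suc m)) (capacity u) ⟩
      oddness (suc m) + (oddness m + capacity u)
        ≡⟨ cong₂ _+_ (cong oddness (count-here u)) (capacity-repeat P∈Cs 1≤m) ⟨
      oddness (count P (just P ∷ u)) + capacity (just P ∷ u) ∎
      where
      open ≤-Reasoning
      m : ℕ
      m = count P u
      rearrange : ∀ a b c → a + b + c ≡ b + (a + c)
      rearrange = solve-∀

    Invariant : List (Maybe C) → Set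
    Invariant [] = ⊤
    Invariant (y ∷ []) = Roomy (y ∷ [])
    Invariant (z ∷ y ∷ u) = Roomy (z ∷ y ∷ u) ⊎ ¬ Same z y × RoomyIfPending z (z ∷ y ∷ u)

    extend-roomy : ∀ z y u → Listed Cs z → Roomy (y ∷ u) → Invariant (z ∷ y ∷ u)
    extend-roomy z y u z∈Cs room with same? z y
    extend-roomy (just P) (just .P) u P∈Cs room | yes refl =
      inj₁ (repeat-roomy P u P∈Cs (<-≤-trans room (m≤n+m _ (pending (just P) (just P ∷ u)))))
    ... | no z≁y = inj₂ (z≁y , prepend-roomy z (y ∷ u) z∈Cs room)

    extend-pending : ∀ z y x u → Listed Cs z → ¬ Same y x → RoomyIfPending y (y ∷ x ∷ u) →
      Paired Same z y x → Invariant (z ∷ y ∷ x ∷ u)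
    extend-pending (just P) (just .P) x u P∈Cs _ room (inj₁ refl) = inj₁ (repeat-roomy P (x ∷ u) P∈Cs room)
    extend-pending z y x u _ y≁x _ (inj₂ (inj₁ y∼x)) = contradiction y∼x y≁x
    extend-pending (just P) y (just .P) u P∈Cs y≁x room (inj₂ (inj₂ refl)) =
      inj₂ ( y≁x ∘ same-sym (just P) y
           , occurring-roomy P (y ∷ just P ∷ u) P∈Cs 1≤m
               (<-≤-trans room (+-monoˡ-≤ (capacity (y ∷ just P ∷ u)) (pending≤1 y _))))
      where
      1≤m : 1 ≤ count P (y ∷ just P ∷ u)
      1≤m = filter-some (≡-decₘ _≟_ (just P)) {xs = y ∷ just P ∷ u} (there (here refl))

    invariant : ∀ u → All (Listed Cs) u → WindowsPaired Same u → Invariant u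
    invariant [] _ _ = tt
    invariant (y ∷ []) (y∈Cs ∷ []) _ = single-roomy y y∈Cs
    invariant (z ∷ y ∷ []) (z∈Cs ∷ y∈Cs ∷ []) _ = extend-roomy z y [] z∈Cs (single-roomy y y∈Cs)
    invariant (z ∷ y ∷ x ∷ u) (z∈Cs ∷ listed) (zyx , paired) with invariant (y ∷ x ∷ u) listed paired
    ... | inj₁ room = extend-roomy z y (x ∷ u) z∈Cs room
    ... | inj₂ (y≁x , room) = extend-pending z y x u z∈Cs y≁x room zyx

    invariant⇒demand≤capacity : ∀ u → Invariant u → demand u ≤ capacity u
    invariant⇒demand≤capacity [] _ = ≤-trans (m≤n+m _ 2) (≤-reflexive (sym capacity-[]))
    invariant⇒demand≤capacity (y ∷ []) room = <⇒≤ room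
    invariant⇒demand≤capacity (z ∷ y ∷ u) (inj₁ room) = <⇒≤ room
    invariant⇒demand≤capacity (z ∷ y ∷ u) (inj₂ (_ , room)) =
      m<1+n⇒m≤n (≤-trans room (+-monoˡ-≤ _ (pending≤1 z _)))

  windowsPaired⇒blanks+length≤Weight+2 : ∀ Cs → Unique Cs → ∀ u → All (Listed Cs) u →
    WindowsPaired Same u → blanks u + length Cs ≤ Weight Cs u + 2
  windowsPaired⇒blanks+length≤Weight+2 Cs unique u listed paired =
    invariant⇒demand≤capacity u (invariant u listed paired)
    where open Capacity Cs unique

module Arrangement {A : Set} (R : A → A → Set) where

  Group : List A → Set
  Group L = 2 ≤ length L × Linked R L

  StartsPaired : List A → Set
  StartsPaired (a ∷ b ∷ _) = R a b
  StartsPaired _ = ⊤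

  -- A group of size m is laid out as ⌊m/2⌋ consecutive blocks of two or three;
  -- a single element may be inserted into each of the ⌊m/2⌋ - 1 gaps between them.
  gaps : List A → ℕ
  gaps L = ⌊ length L /2⌋ ∸ 1

  mutual
    arrange : List A → List (List A) → List A
    arrange ss [] = ss
    arrange ss (L ∷ Ls) = weave ss L Ls

    weave : List A → List A → List (List A) → List A
    weave ss (a ∷ b ∷ L) Ls = a ∷ b ∷ after ss L Ls
    weave ss L Ls = L ++ arrange ss Ls

    after : List A → List A → List (List A) → List A
    after ss (c ∷ d ∷ L) Ls = fill ss (c ∷ d ∷ L) Ls
    after ss L Ls = L ++ arrange ss Ls

    fill : List A → List A → List (List A) → List A
    fill [] L Ls = weave [] L Ls
    fill (s ∷ ss) L Ls = s ∷ weave ss L Ls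

  arrangement : List A → List (List A) → List A
  arrangement [] Ls = arrange [] Ls
  arrangement (s ∷ ss) Ls = s ∷ arrange ss Ls

  cons-paired : ∀ {s : A} {v} → WindowsPaired R v → StartsPaired v → WindowsPaired R (s ∷ v)
  cons-paired {v = []} _ _ = tt
  cons-paired {v = _ ∷ []} _ _ = tt
  cons-paired {v = _ ∷ _ ∷ _} paired start = inj₂ (inj₁ start) , paired

  cons-paired-pair : ∀ {a b v} → R a b → WindowsPaired R v → StartsPaired v →
                     WindowsPaired R (a ∷ b ∷ v)
  cons-paired-pair {v = []} ab _ _ = tt
  cons-paired-pair {v = _ ∷ []} ab _ _ = inj₁ ab , tt
  cons-paired-pair {v = _ ∷ _ ∷ _} ab paired start = inj₁ ab , inj₂ (inj₁ start) , paired

  Σgaps : List (List A) → ℕ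
  Σgaps Ls = sum (map gaps Ls)

  mutual
    arrange-windowsPaired : ∀ ss Ls → All Group Ls → length ss ≤ 1 + Σgaps Ls →
      WindowsPaired R (arrange ss Ls) × StartsPaired (arrange ss Ls)
    arrange-windowsPaired [] [] _ _ = tt , tt
    arrange-windowsPaired (_ ∷ []) [] _ _ = tt , tt
    arrange-windowsPaired (_ ∷ _ ∷ _) [] _ (s≤s ())
    arrange-windowsPaired ss (L ∷ Ls) (g ∷ gs) room = weave-windowsPaired ss L Ls g gs room

    weave-windowsPaired : ∀ ss L Ls → Group L → All Group Ls → length ss ≤ 1 + (gaps L + Σgaps Ls) →
      WindowsPaired R (weave ss L Ls) × StartsPaired (weave ss L Ls)
    weave-windowsPaired ss (_ ∷ []) Ls (s≤s () , _) gs room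
    weave-windowsPaired ss (a ∷ b ∷ []) Ls (_ , ab ∷ [-]) gs room =
      let paired , start = arrange-windowsPaired ss Ls gs room
      in cons-paired-pair ab paired start , ab
    weave-windowsPaired ss (a ∷ b ∷ c ∷ []) Ls (_ , ab ∷ bc ∷ [-]) gs room =
      let paired , start = arrange-windowsPaired ss Ls gs room
      in (inj₁ ab , cons-paired-pair bc paired start) , ab
    weave-windowsPaired [] (a ∷ b ∷ c ∷ d ∷ L) Ls (_ , ab ∷ bc ∷ chain) gs _ =
      let paired , start = weave-windowsPaired [] (c ∷ d ∷ L) Ls (s≤s (s≤s z≤n) , chain) gs z≤n
      in cons-paired-pair ab paired start , ab
    weave-windowsPaired (s ∷ ss) (a ∷ b ∷ c ∷ d ∷ L) Ls (_ , ab ∷ bc ∷ chain@(cd ∷ _)) gs (s≤s room) =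
      let paired , _ = weave-windowsPaired ss (c ∷ d ∷ L) Ls (s≤s (s≤s z≤n) , chain) gs room
      in (inj₁ ab , inj₂ (inj₂ bc) , inj₂ (inj₁ cd) , paired) , ab

  arrangement-windowsPaired : ∀ ss Ls → All Group Ls → length ss ≤ 2 + Σgaps Ls →
                              WindowsPaired R (arrangement ss Ls)
  arrangement-windowsPaired [] Ls gs _ = proj₁ (arrange-windowsPaired [] Ls gs z≤n)
  arrangement-windowsPaired (s ∷ ss) Ls gs (s≤s room) =
    let paired , start = arrange-windowsPaired ss Ls gs room in cons-paired paired start

  mutual
    arrange-↭ : ∀ ss Ls → arrange ss Ls ↭ ss ++ concat Ls
    arrange-↭ ss [] = ↭-reflexive (sym (++-identityʳ ss))
    arrange-↭ ss (L ∷ Ls) = weave-↭ ss L Ls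

    weave-↭ : ∀ ss L Ls → weave ss L Ls ↭ ss ++ L ++ concat Ls
    weave-↭ ss [] Ls = arrange-↭ ss Ls
    weave-↭ ss (a ∷ []) Ls = ↭-trans (prep a (arrange-↭ ss Ls)) (shifts (a ∷ []) ss)
    weave-↭ ss (a ∷ b ∷ L) Ls = ↭-trans (prep a (prep b (after-↭ ss L Ls))) (shifts (a ∷ b ∷ []) ss)

    after-↭ : ∀ ss L Ls → after ss L Ls ↭ ss ++ L ++ concat Ls
    after-↭ ss [] Ls = arrange-↭ ss Ls
    after-↭ ss (c ∷ []) Ls = ↭-trans (prep c (arrange-↭ ss Ls)) (shifts (c ∷ []) ss)
    after-↭ [] (c ∷ d ∷ L) Ls = weave-↭ [] (c ∷ d ∷ L) Ls
    after-↭ (s ∷ ss) (c ∷ d ∷ L) Ls = prep s (weave-↭ ss (c ∷ d ∷ L) Ls)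

  arrangement-↭ : ∀ ss Ls → arrangement ss Ls ↭ ss ++ concat Ls
  arrangement-↭ [] Ls = arrange-↭ [] Ls
  arrangement-↭ (s ∷ ss) Ls = prep s (arrange-↭ ss Ls)


module Characterisation {n : ℕ} (M : Matroid n) (rank3 : HasRank3 M) (noCircuit3 : NoCircuitOfSize3 M)
  (Ps : List (Subset n)) (unique-Ps : Unique Ps)
  (Ps⇔ : ∀ P → (P ∈L Ps) ⇔ (IsParallelClass M P × 2 ≤ ∣ P ∣))
  (N : Subset n) (N⇔ : ∀ x → (x ∈ N) ⇔ (NonLoop M x × (∀ y → ¬ Parallel M x y))) where

  open Matroid M
  open MatroidProperties M
  open WithEquicardinalBases (λ B B′ basis basis′ → trans (rank3 B basis) (sym (rank3 B′ basis′)))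
  open Equivalence using (to; from)

  private variable
    P : Subset n

  Ps-class : P ∈L Ps → IsParallelClass M P
  Ps-class {P} = proj₁ ∘ to (Ps⇔ P)

  Ps-size : P ∈L Ps → 2 ≤ ∣ P ∣
  Ps-size {P} = proj₂ ∘ to (Ps⇔ P)

  N-isolated : x ∈ N → ¬ Parallel M x y
  N-isolated {x} {y} x∈N = proj₂ (to (N⇔ x) x∈N) y

  N∩Ps≡∅ : x ∈ N → P ∈L Ps → x ∉ P
  N∩Ps≡∅ {x} {P} x∈N P∈Ps x∈P = contradiction 2≤1 λ { (s≤s ()) }
    where
    P⊆⁅x⁆ : P ⊆ ⁅ x ⁆
    P⊆⁅x⁆ {y} y∈P with class-∈⇒parallel (Ps-class P∈Ps) x∈P y∈P
    ... | inj₁ refl = x∈⁅x⁆ x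
    ... | inj₂ x∥y = contradiction x∥y (N-isolated x∈N)
    2≤1 : 2 ≤ 1
    2≤1 = ≤-trans (Ps-size P∈Ps) (≤-trans (p⊆q⇒∣p∣≤∣q∣ P⊆⁅x⁆) (≤-reflexive (∣⁅x⁆∣≡1 x)))

  nonLoop⇒N⊎Ps : NonLoop M x → x ∈ N ⊎ ∃ λ P → P ∈L Ps × x ∈ P
  nonLoop⇒N⊎Ps {x} nx with any? (parallel? x)
  ... | no isolated = inj₁ (from (N⇔ x) (nx , λ y x∥y → isolated (y , x∥y)))
  ... | yes (y , x∥y@(_ , _ , x≢y , _)) with class-of x∥y
  ...   | P , P-class , x∈P , y∈P = inj₂ (P , from (Ps⇔ P) (P-class , 2≤∣P∣) , x∈P)
    where
    2≤∣P∣ : 2 ≤ ∣ P ∣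
    2≤∣P∣ = length≤∣p∣ ((x≢y ∷ []) ∷ [] ∷ []) (x∈P ∷ y∈P ∷ [])

  _≟ₛ_ : DecidableEquality (Subset n)
  _≟ₛ_ = Vec.≡-dec Bool._≟_

  open Colours _≟ₛ_

  colour : Fin n → Maybe (Subset n)
  colour x = find (x ∈?_) Ps

  colour-just⁻ : colour x ≡ just P → P ∈L Ps × x ∈ P
  colour-just⁻ {x} = find-just⁻ (x ∈?_) Ps

  colour-class : P ∈L Ps → x ∈ P → colour x ≡ just P
  colour-class {P} {x} P∈Ps x∈P = find-just (x ∈?_) Ps P∈Ps x∈P
    (All.tabulate λ Q∈Ps x∈Q → class-unique (Ps-class Q∈Ps) (Ps-class P∈Ps) x∈Q x∈P)

  colour-N : x ∈ N → colour x ≡ nothing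
  colour-N {x} x∈N = find-nothing (x ∈?_) Ps (All.tabulate (N∩Ps≡∅ x∈N))

  colour-listed : ∀ x → Listed Ps (colour x)
  colour-listed x with colour x in eq
  ... | nothing = tt
  ... | just P = proj₁ (colour-just⁻ eq)

  SameColour : Fin n → Fin n → Set
  SameColour x y = Same (colour x) (colour y)

  class⇒sameColour : P ∈L Ps → x ∈ P → y ∈ P → SameColour x y
  class⇒sameColour P∈Ps x∈P y∈P rewrite colour-class P∈Ps x∈P | colour-class P∈Ps y∈P = refl

  parallel⇒sameColour : Parallel M x y → SameColour x y
  parallel⇒sameColour {x} {y} x∥y with nonLoop⇒N⊎Ps (proj₁ x∥y)
  ... | inj₁ x∈N = contradiction x∥y (N-isolated x∈N)
  ... | inj₂ (P , P∈Ps , x∈P) = class⇒sameColour P∈Ps x∈P (class-closed (Ps-class P∈Ps) x∈P x∥y)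

  sameColour⇒parallel : SameColour x y → x ≡ y ⊎ Parallel M x y
  sameColour⇒parallel {x} {y} same with colour x in eqx | colour y in eqy
  sameColour⇒parallel refl | just P | just .P with colour-just⁻ eqx | colour-just⁻ eqy
  ... | P∈Ps , x∈P | _ , y∈P = class-∈⇒parallel (Ps-class P∈Ps) x∈P y∈P

  module _ {w : List (Fin n)} (ordering : IsOrderingOfNonLoops M w) where

    private
      unique-w : Unique w
      unique-w = proj₁ ordering
      w⇔ : ∀ x → x ∈L w ⇔ NonLoop M x
      w⇔ = proj₂ ordering

    count-colours : P ∈L Ps → count P (map colour w) ≡ ∣ P ∣
    count-colours {P} P∈Ps = trans (length-filter-map (≡-decₘ _≟ₛ_ (just P)) colour w)
      (length≡∣p∣ (Unique.filter⁺ _ unique-w) λ y → mk⇔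
        (λ y∈ → proj₂ (colour-just⁻ (sym (proj₂ (∈-filter⁻ _ {xs = w} y∈)))))
        (λ y∈P → ∈-filter⁺ _ (from (w⇔ y) (class-∈⇒nonLoop (Ps-class P∈Ps) y∈P))
                              (sym (colour-class P∈Ps y∈P))))

    blanks-colours : blanks (map colour w) ≡ ∣ N ∣
    blanks-colours = trans (length-filter-map (≡-decₘ _≟ₛ_ nothing) colour w)
      (length≡∣p∣ (Unique.filter⁺ _ unique-w) λ y → mk⇔
        (λ y∈ → let y∈w , blank = ∈-filter⁻ _ {xs = w} y∈ in blank⇒N (to (w⇔ y) y∈w) blank)
        (λ y∈N → ∈-filter⁺ _ (from (w⇔ y) (proj₁ (to (N⇔ y) y∈N))) (sym (colour-N y∈N))))
      where
      blank⇒N : NonLoop M y → nothing ≡ colour y → y ∈ N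
      blank⇒N ny blank with nonLoop⇒N⊎Ps ny
      ... | inj₁ y∈N = y∈N
      ... | inj₂ (P , P∈Ps , y∈P) = contradiction (trans blank (colour-class P∈Ps y∈P)) λ ()

    Weight-colours : Weight Ps (map colour w) ≡ halfSum Ps
    Weight-colours = cong sum (map-cong-local (All.tabulate λ P∈Ps →
      trans (cong weight (count-colours P∈Ps)) (weight≡/2 (≤-trans (s≤s z≤n) (Ps-size P∈Ps)))))

    windowsPaired⇒∣N∣+k≤halfSum+2 : WindowsPaired SameColour w → ∣ N ∣ + length Ps ≤ halfSum Ps + 2
    windowsPaired⇒∣N∣+k≤halfSum+2 paired =
      subst₂ (λ b W → b + length Ps ≤ W + 2) blanks-colours Weight-colours
        (windowsPaired⇒blanks+length≤Weight+2 Ps unique-Ps (map colour w)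
          (All.map⁺ (All.universal colour-listed w)) (WindowsPaired-map colour w paired))

  BasisTriple : Fin n × Fin n × Fin n → Set
  BasisTriple (a , b , c) = Basis M (triple a b c)

  basisTriple? : ∀ t → Dec (BasisTriple t)
  basisTriple? (a , b , c) = isBasis (triple a b c) Bool.≟ Bool.true

  basis⊎paired : NonLoop M a → NonLoop M b → NonLoop M c → a ≢ b → a ≢ c → b ≢ c →
    Basis M (triple a b c) ⊎ Paired SameColour a b c
  basis⊎paired {a} {b} {c} na nb nc a≢b a≢c b≢c with parallel? a b | parallel? b c | parallel? a c
  ... | yes a∥b | _       | _       = inj₂ (inj₁ (parallel⇒sameColour a∥b))
  ... | no _    | yes b∥c | _       = inj₂ (inj₂ (inj₁ (parallel⇒sameColour b∥c)))
  ... | no _    | no _    | yes a∥c = inj₂ (inj₂ (inj₂ (parallel⇒sameColour a∥c)))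
  ... | no a∦b  | no b∦c  | no a∦c  = inj₁ (pairwise-independent⇒basis rank3 noCircuit3 a≢b a≢c b≢c
        (¬parallel⇒independent na nb a≢b a∦b)
        (¬parallel⇒independent na nc a≢c a∦c)
        (¬parallel⇒independent nb nc b≢c b∦c))

  paired⇒¬basis : a ≢ b → a ≢ c → b ≢ c → Paired SameColour a b c → ¬ Basis M (triple a b c)
  paired⇒¬basis {a} {b} {c} a≢b a≢c b≢c paired basis =
    Sum.[ apart a≢b (a∈triple a b c) (b∈triple a b c)
        , Sum.[ apart b≢c (b∈triple a b c) (c∈triple a b c)
              , apart a≢c (a∈triple a b c) (c∈triple a b c) ] ]
      paired
    where
    apart : x ≢ y → x ∈ triple a b c → y ∈ triple a b c → ¬ SameColour x y
    apart x≢y x∈ y∈ same with sameColour⇒parallel same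
    ... | inj₁ x≡y = x≢y x≡y
    ... | inj₂ x∥y = ∈basis⇒¬parallel basis x∈ y∈ x∥y

  ¬basis-triple⇒windowsPaired : ∀ w → Unique w → All (NonLoop M) w →
    ¬ Any BasisTriple (triples M w) → WindowsPaired SameColour w
  ¬basis-triple⇒windowsPaired (a ∷ b ∷ c ∷ w)
    ((a≢b ∷ a≢c ∷ _) ∷ unique@((b≢c ∷ _) ∷ _)) (na ∷ nonLoops@(nb ∷ nc ∷ _)) none =
      Sum.[ (λ basis → contradiction (here basis) none) , id ] (basis⊎paired na nb nc a≢b a≢c b≢c)
    , ¬basis-triple⇒windowsPaired (b ∷ c ∷ w) unique nonLoops (none ∘ there)
  ¬basis-triple⇒windowsPaired [] _ _ _ = tt
  ¬basis-triple⇒windowsPaired (_ ∷ []) _ _ _ = tt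
  ¬basis-triple⇒windowsPaired (_ ∷ _ ∷ []) _ _ _ = tt

  windowsPaired⇒¬basis-triple : ∀ w → Unique w → WindowsPaired SameColour w →
    ¬ Any BasisTriple (triples M w)
  windowsPaired⇒¬basis-triple (a ∷ b ∷ c ∷ w) ((a≢b ∷ a≢c ∷ _) ∷ (b≢c ∷ _) ∷ _) (abc , _) (here basis) =
    paired⇒¬basis a≢b a≢c b≢c abc basis
  windowsPaired⇒¬basis-triple (a ∷ b ∷ c ∷ w) (_ ∷ unique) (_ , paired) (there found) =
    windowsPaired⇒¬basis-triple (b ∷ c ∷ w) unique paired found

  open Arrangement SameColour
  open import Data.List.Relation.Binary.Permutation.Setoid.Properties (setoid (Fin n)) using (Unique-resp-↭)

  groups : List (List (Fin n))
  groups = map elements Ps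

  ∈groups⁻ : y ∈L concat groups → ∃ λ P → P ∈L Ps × y ∈ P
  ∈groups⁻ {y} y∈ with ∈-concat⁻′ groups y∈
  ... | L , y∈L , L∈ with ∈-map⁻ elements L∈
  ...   | P , P∈Ps , refl = P , P∈Ps , to ∈elements⇔ y∈L

  class-linked : P ∈L Ps → ∀ {xs} → All (_∈ P) xs → Linked SameColour xs
  class-linked P∈Ps [] = []
  class-linked P∈Ps (_ ∷ []) = [-]
  class-linked P∈Ps (x∈P ∷ rest@(y∈P ∷ _)) = class⇒sameColour P∈Ps x∈P y∈P ∷ class-linked P∈Ps rest

  groups-valid : All Group groups
  groups-valid = All.map⁺ (All.tabulate λ {P} P∈Ps →
      ≤-trans (Ps-size P∈Ps) (≤-reflexive (sym (length-elements P)))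
    , class-linked P∈Ps (All.tabulate (to ∈elements⇔)))

  Σgaps+length≡halfSum : ∀ Qs → All (λ Q → 2 ≤ ∣ Q ∣) Qs →
    Σgaps (map elements Qs) + length Qs ≡ halfSum Qs
  Σgaps+length≡halfSum [] [] = refl
  Σgaps+length≡halfSum (Q ∷ Qs) (2≤∣Q∣ ∷ sizes) = begin
    gaps (elements Q) + Σgaps (map elements Qs) + suc (length Qs)
      ≡⟨ rearrange (gaps (elements Q)) (Σgaps (map elements Qs)) (length Qs) ⟩
    suc (gaps (elements Q)) + (Σgaps (map elements Qs) + length Qs)
      ≡⟨ cong₂ _+_ gaps-Q (Σgaps+length≡halfSum Qs sizes) ⟩
    ∣ Q ∣ / 2 + halfSum Qs ∎
    where
    open ≡-Reasoning
    rearrange : ∀ a b c → a + b + suc c ≡ suc a + (b + c)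
    rearrange = solve-∀
    gaps-Q : suc (⌊ length (elements Q) /2⌋ ∸ 1) ≡ ∣ Q ∣ / 2
    gaps-Q rewrite length-elements Q =
      trans (+-comm 1 _) (trans (m∸n+n≡m (⌊n/2⌋-mono 2≤∣Q∣)) (⌊n/2⌋≡n/2 ∣ Q ∣))

  arrangement₀ : List (Fin n)
  arrangement₀ = arrangement (elements N) groups

  arrangement₀-windowsPaired : ∣ N ∣ + length Ps ≤ halfSum Ps + 2 →
    WindowsPaired SameColour arrangement₀
  arrangement₀-windowsPaired room =
    arrangement-windowsPaired (elements N) groups groups-valid (+-cancelʳ-≤ (length Ps) _ _ (begin
      length (elements N) + length Ps
        ≡⟨ cong (_+ length Ps) (length-elements N) ⟩
      ∣ N ∣ + length Ps
        ≤⟨ room ⟩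
      halfSum Ps + 2
        ≡⟨ cong (_+ 2) (Σgaps+length≡halfSum Ps (All.tabulate Ps-size)) ⟨
      Σgaps groups + length Ps + 2
        ≡⟨ rearrange (Σgaps groups) (length Ps) ⟩
      2 + Σgaps groups + length Ps ∎))
    where
    open ≤-Reasoning
    rearrange : ∀ a b → a + b + 2 ≡ 2 + a + b
    rearrange = solve-∀

  arrangement₀-ordering : IsOrderingOfNonLoops M arrangement₀
  arrangement₀-ordering =
      Unique-resp-↭ (↭⇒↭ₛ (↭-sym arrangement₀↭)) unique
    , λ y → mk⇔ (nonLoop ∘ ∈-resp-↭ arrangement₀↭) (∈-resp-↭ (↭-sym arrangement₀↭) ∘ listed)
    where
    arrangement₀↭ : arrangement₀ ↭ elements N ++ concat groups
    arrangement₀↭ = arrangement-↭ (elements N) groups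
    disjoint-groups : AllPairs Disjoint groups
    disjoint-groups = AllPairs-map-local (λ P∈Ps Q∈Ps P≢Q (x∈P , x∈Q) →
      P≢Q (class-unique (Ps-class P∈Ps) (Ps-class Q∈Ps) (to ∈elements⇔ x∈P) (to ∈elements⇔ x∈Q)))
      unique-Ps
    unique : Unique (elements N ++ concat groups)
    unique = Unique.++⁺ (elements-unique N)
      (Unique.concat⁺ (All.map⁺ (All.universal elements-unique Ps)) disjoint-groups)
      λ (y∈N , y∈groups) → let P , P∈Ps , y∈P = ∈groups⁻ y∈groups in
        N∩Ps≡∅ (to ∈elements⇔ y∈N) P∈Ps y∈P
    nonLoop : y ∈L elements N ++ concat groups → NonLoop M y
    nonLoop {y} y∈ with ∈-++⁻ (elements N) y∈
    ... | inj₁ y∈N = proj₁ (to (N⇔ y) (to ∈elements⇔ y∈N))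
    ... | inj₂ y∈groups = let P , P∈Ps , y∈P = ∈groups⁻ y∈groups in class-∈⇒nonLoop (Ps-class P∈Ps) y∈P
    listed : NonLoop M y → y ∈L elements N ++ concat groups
    listed ny with nonLoop⇒N⊎Ps ny
    ... | inj₁ y∈N = ∈-++⁺ˡ (from ∈elements⇔ y∈N)
    ... | inj₂ (P , P∈Ps , y∈P) =
      ∈-++⁺ʳ (elements N) (∈-concat⁺′ (from ∈elements⇔ y∈P) (∈-map⁺ elements P∈Ps))

  inequality⇒DJS : halfSum Ps + 2 < ∣ N ∣ + length Ps → IsDJS M
  inequality⇒DJS ineq w ordering@(unique-w , w⇔) with Any.any? basisTriple? (triples M w)
  ... | yes found = found
  ... | no none = contradiction (windowsPaired⇒∣N∣+k≤halfSum+2 ordering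
          (¬basis-triple⇒windowsPaired w unique-w (All.tabulate (to (w⇔ _))) none)) (<⇒≱ ineq)

  DJS⇒inequality : IsDJS M → halfSum Ps + 2 < ∣ N ∣ + length Ps
  DJS⇒inequality djs with halfSum Ps + 2 <? ∣ N ∣ + length Ps
  ... | yes ineq = ineq
  ... | no ¬ineq = contradiction (djs arrangement₀ arrangement₀-ordering)
        (windowsPaired⇒¬basis-triple arrangement₀ (proj₁ arrangement₀-ordering)
          (arrangement₀-windowsPaired (≮⇒≥ ¬ineq)))

proposition6p7 : (n : ℕ) (M : Matroid n) → HasRank3 M → NoCircuitOfSize3 M →
    (Ps : List (Subset n)) → Unique Ps →
    (∀ P → (P ∈L Ps) ⇔ (IsParallelClass M P × 2 ≤ ∣ P ∣)) →
    (N : Subset n) →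
    (∀ x → (x ∈ N) ⇔ (NonLoop M x × (∀ y → ¬ Parallel M x y))) →
    IsDJS M ⇔ DJSInequality Ps N
proposition6p7 n M rank3 noCircuit3 Ps unique-Ps Ps⇔ N N⇔ = mk⇔
  (Equivalence.from ineq⇔ ∘ DJS⇒inequality)
  (inequality⇒DJS ∘ Equivalence.to ineq⇔)
  where
  open Characterisation M rank3 noCircuit3 Ps unique-Ps Ps⇔ N N⇔
  ineq⇔ : DJSInequality Ps N ⇔ halfSum Ps + 2 < ∣ N ∣ + length Ps
  ineq⇔ = +m-+n<+o-+p⇔m+p<o+n (halfSum Ps) (length Ps) ∣ N ∣ 2
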